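{- For every integer $d \geq 2$, $L_d \geq L^\circ_d \geq 2^{3 \cdot 2^{\lfloor d/2 \rfloor - 1} - 1}$.
   Context: For $a,b \in \mathbb{N}$ write $a \rightarrow b$ iff either $b = a+1$ or $b = 0$. For vectors $v,w \in \mathbb{N}^d$ write $v \rightarrow w$ iff $v^\ell \rightarrow w^\ell$ for every coordinate $\ell$, and $v \leq w$ iff $v^\ell \leq w^\ell$ for every coordinate $\ell$. A sequence $(v_0,\ldots,v_{n-1})$ of vectors in $\mathbb{N}^d$ is valid iff $v_i \rightarrow v_{i+1}$ for each $i < n-1$; it is cyclic iff it is valid and additionally $v_{n-1} \rightarrow v_0$. A sequence is non-dominating iff $v_i \not\leq v_j$ whenever $i < j$. $L_d$ denotes the maximum length of a non-dominating valid sequence of vectors in $\mathbb{N}^d$, and $L^\circ_d$ denotes the maximum length of a non-dominating cyclic sequence of vectors in $\mathbb{N}^d$. -}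

module Defs where

open import Data.Nat using (ℕ; zero; suc; _≤_; _<_)
open import Data.Fin using (Fin; toℕ)
open import Data.Product using (Σ; _×_)
open import Data.Sum using (_⊎_)
open import Relation.Nullary using (¬_)
open import Relation.Binary.PropositionalEquality using (_≡_)

Vecℕ : ℕ → Set
Vecℕ d = Fin d → ℕ

_⇝_ : ℕ → ℕ → Set
a ⇝ b = (b ≡ suc a) ⊎ (b ≡ 0)

_⇝ᵛ_ : ∀ {d} → Vecℕ d → Vecℕ d → Set
_⇝ᵛ_ {d} v w = (ℓ : Fin d) → v ℓ ⇝ w ℓ

_≤ᵛ_ : ∀ {d} → Vecℕ d → Vecℕ d → Set
_≤ᵛ_ {d} v w = (ℓ : Fin d) → v ℓ ≤ w ℓ

Seq : ℕ → ℕ → Set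
Seq d n = Fin n → Vecℕ d

Valid : ∀ {d n} → Seq d n → Set
Valid {d} {n} v = (i j : Fin n) → toℕ j ≡ suc (toℕ i) → v i ⇝ᵛ v j

Cyclic : ∀ {d n} → Seq d n → Set
Cyclic {d} {n} v =
  Valid v × ((i j : Fin n) → suc (toℕ i) ≡ n → toℕ j ≡ 0 → v i ⇝ᵛ v j)

NonDominating : ∀ {d n} → Seq d n → Set
NonDominating {d} {n} v = (i j : Fin n) → toℕ i < toℕ j → ¬ (v i ≤ᵛ v j)

IsMaxLength : (d : ℕ) → (∀ {n} → Seq d n → Set) → ℕ → Set
IsMaxLength d P m =
  Σ (Seq d m) (λ v → P v)
  × ((n : ℕ) (v : Seq d n) → P v → n ≤ m)

IsL : ℕ → ℕ → Set
IsL d m = IsMaxLength d (λ v → Valid v × NonDominating v) m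

IsL° : ℕ → ℕ → Set
IsL° d m = IsMaxLength d (λ v → Cyclic v × NonDominating v) m

-- L_d ≥ L°_d because a cyclic sequence is valid. For the lower bound, a cyclic non-dominating
-- sequence S of length N in ℕ^d yields one of length 2N² in ℕ^(d+2): run through S 2N times,
-- in rounds j < N split into halves b < 2, and prepend two coordinates. In half 0 of round j at
-- position p they are (r_j p , p + N - j), in half 1 they are (p + N - j , r_(j+1) p), where the
-- counter r_j p = p resets to 0 at p = j. Between an earlier position p and a later position p',
-- the coordinates of S exclude domination if p < p'; if p' ≤ p, the later one lies in a later
-- half, where either the descent p + N - j has dropped (same b) or it meets a counter
-- r q ≤ q ≤ p < p + N - j (other b). Starting from a cycle of length 4 in ℕ² and padding odd
-- dimensions with a zero coordinate, N ↦ 2N² gives length 2^(3·2^e - 1) in dimension 2e + 2.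
module Submission where

open import Defs
open import Data.Nat using (ℕ; _≤_; _^_; _*_; _∸_; _/_)
open import Data.Product using (Σ; _×_)

open import Data.Empty using (⊥)
open import Data.Fin using (Fin; toℕ; quotient; remainder)
open import Data.Fin.Patterns using (0F; 1F)
open import Data.Fin.Properties using (all?; toℕ<n; toℕ-injective; combine-remQuot; toℕ-combine)
open import Data.Nat using (suc; _+_; _<_; z≤n; s≤s; z<s; _≟_; _<?_; _≤?_)
open import Data.Nat.DivMod using (m/n≡1+[m∸n]/n)
open import Data.Nat.Properties
open import Data.Product using (_,_; proj₁; proj₂; uncurry)
open import Data.Sum using (_⊎_; inj₁; inj₂; map₂)
open import Data.Unit using (tt)
open import Data.Vec.Functional using ([]; _∷_; _++_)
import Data.Vec.Functional.Relation.Binary.Pointwise.Properties as Pointwise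
open import Relation.Binary.Definitions using (Decidable; tri<; tri≈; tri>)
open import Relation.Binary.PropositionalEquality
open import Relation.Nullary using (¬_; Dec; yes; no; contradiction)
open import Relation.Nullary.Decidable using (_⊎-dec_; _×-dec_; _→-dec_; ¬?; toWitness)

Wraps : ∀ {n} → Fin n → Fin n → Set
Wraps {n} i j = suc (toℕ i) ≡ n × toℕ j ≡ 0

Consecutive : ∀ {n} → Fin n → Fin n → Set
Consecutive i j = toℕ j ≡ suc (toℕ i) ⊎ Wraps i j

CyclicNonDominating : ∀ {d n} → Seq d n → Set
CyclicNonDominating v = Cyclic v × NonDominating v

LongCycle : ℕ → ℕ → Set
LongCycle d n = Σ (Seq d n) CyclicNonDominating

cyclic-intro : ∀ {d n} {v : Seq d n} → (∀ i j → Consecutive i j → v i ⇝ᵛ v j) → Cyclic v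
cyclic-intro step = (λ i j e → step i j (inj₁ e)) , (λ i j e₁ e₂ → step i j (inj₂ (e₁ , e₂)))

cyclic-step : ∀ {d n} {v : Seq d n} → Cyclic v → ∀ i j → Consecutive i j → v i ⇝ᵛ v j
cyclic-step (valid , _) i j (inj₁ e) = valid i j e
cyclic-step (_ , wrap) i j (inj₂ (e₁ , e₂)) = wrap i j e₁ e₂

infixr 5 _⊕_

_⊕_ : ∀ {d e n} → Seq d n → Seq e n → Seq (d + e) n
(u ⊕ v) k = u k ++ v k

⊕-cyclic : ∀ {d e n} {u : Seq d n} {v : Seq e n} → Cyclic u → Cyclic v → Cyclic (u ⊕ v)
⊕-cyclic cu cv = cyclic-intro λ i j c →
  Pointwise.++⁺ _⇝_ (cyclic-step cu i j c) (cyclic-step cv i j c)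

⊕-nonDominating : ∀ {d e n} {u : Seq d n} {v : Seq e n} →
                  (∀ i j → toℕ i < toℕ j → u i ≤ᵛ u j → v i ≤ᵛ v j → ⊥) → NonDominating (u ⊕ v)
⊕-nonDominating {u = u} separated i j i<j le =
  uncurry (separated i j i<j) (Pointwise.++⁻ _≤_ (u i) (u j) le)

zeros : ∀ {n} → Seq 1 n
zeros _ _ = 0

pad : ∀ {d n} {v : Seq d n} → CyclicNonDominating v → CyclicNonDominating (zeros ⊕ v)
pad (cyc , nd) = ⊕-cyclic (cyclic-intro λ _ _ _ _ → inj₂ refl) cyc
               , ⊕-nonDominating λ i j i<j _ → nd i j i<j

lex-< : ∀ n {c c' p} p' → c < c' → p < n → n * c + p < n * c' + p'
lex-< n {c} {c'} {p} p' c<c' p<n = begin-strict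
  n * c + p   <⟨ +-monoʳ-< (n * c) p<n ⟩
  n * c + n   ≡⟨ +-comm (n * c) n ⟩
  n + n * c   ≡⟨ *-suc n c ⟨
  n * suc c   ≤⟨ *-monoʳ-≤ n c<c' ⟩
  n * c'      ≤⟨ m≤m+n (n * c') p' ⟩
  n * c' + p' ∎
  where open ≤-Reasoning

lex-injective : ∀ n {c c' p p'} → p < n → p' < n → n * c + p ≡ n * c' + p' → c ≡ c' × p ≡ p'
lex-injective n {c} {c'} {p} {p'} p<n p'<n eq with <-cmp c c'
... | tri< c<c' _ _ = contradiction eq (<⇒≢ (lex-< n p' c<c' p<n))
... | tri≈ _ refl _ = refl , +-cancelˡ-≡ (n * c) p p' eq
... | tri> _ _ c'<c = contradiction (sym eq) (<⇒≢ (lex-< n p c'<c p'<n))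

lex-<-inv : ∀ n {c c' p p'} → p < n → p' < n → n * c + p < n * c' + p' → c < c' ⊎ (c ≡ c' × p < p')
lex-<-inv n {c} {c'} {p} {p'} p<n p'<n lt with <-cmp c c'
... | tri< c<c' _ _ = inj₁ c<c'
... | tri≈ _ refl _ = inj₂ (refl , +-cancelˡ-< (n * c) p p' lt)
... | tri> _ _ c'<c = contradiction lt (<⇒≯ (lex-< n p c'<c p'<n))

lex-carry : ∀ n c p → suc p ≡ n → n * suc c + 0 ≡ suc (n * c + p)
lex-carry n c p refl = begin
  n * suc c + 0   ≡⟨ +-identityʳ (n * suc c) ⟩
  n * suc c       ≡⟨ *-suc n c ⟩
  n + n * c       ≡⟨ +-comm n (n * c) ⟩
  n * c + suc p   ≡⟨ +-suc (n * c) p ⟩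
  suc (n * c + p) ∎
  where open ≡-Reasoning

lex-suc-inv : ∀ n {c c' p p'} → p < n → p' < n → suc (n * c + p) ≡ n * c' + p' →
              (c ≡ c' × p' ≡ suc p) ⊎ (c' ≡ suc c × suc p ≡ n × p' ≡ 0)
lex-suc-inv n {c} {p = p} p<n p'<n eq with m≤n⇒m<n∨m≡n p<n
... | inj₁ sp<n
  with c≡c' , sp≡p' ← lex-injective n sp<n p'<n (trans (+-suc (n * c) p) eq)
  = inj₁ (c≡c' , sym sp≡p')
... | inj₂ sp≡n
  with sc≡c' , 0≡p' ← lex-injective n (<-≤-trans z<s p<n) p'<n (trans (lex-carry n c p sp≡n) eq)
  = inj₂ (sym sc≡c' , sp≡n , sym 0≡p')

lex-zero-inv : ∀ n {c p} → p < n → n * c + p ≡ 0 → c ≡ 0 × p ≡ 0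
lex-zero-inv n {c} p<n eq with m*n≡0⇒m≡0∨n≡0 n (m+n≡0⇒m≡0 (n * c) eq)
... | inj₁ refl = contradiction p<n n≮0
... | inj₂ c≡0 = c≡0 , m+n≡0⇒n≡0 (n * c) eq

lex-last-inv : ∀ m n {c p} → p < n → suc (n * c + p) ≡ m * n → suc c ≡ m × suc p ≡ n
lex-last-inv m n p<n eq
  with lex-suc-inv n p<n (<-≤-trans z<s p<n)
         (trans eq (trans (*-comm m n) (sym (+-identityʳ (n * m)))))
... | inj₁ (_ , ())
... | inj₂ (m≡sc , sp≡n , _) = sym m≡sc , sp≡n

module _ {m : ℕ} (n : ℕ) where

  private
    q : Fin (m * n) → Fin m
    q = quotient {m} n

    r : Fin (m * n) → Fin n
    r = remainder {m} n

  toℕ-remQuot : ∀ k → toℕ k ≡ n * toℕ (q k) + toℕ (r k)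
  toℕ-remQuot k = trans (cong toℕ (sym (combine-remQuot {m} n k))) (toℕ-combine (q k) (r k))

  remQuot-<-inv : ∀ k k' → toℕ k < toℕ k' →
                  toℕ (q k) < toℕ (q k') ⊎ (q k ≡ q k' × toℕ (r k) < toℕ (r k'))
  remQuot-<-inv k k' lt
    with lex-<-inv n (toℕ<n (r k)) (toℕ<n (r k')) (subst₂ _<_ (toℕ-remQuot k) (toℕ-remQuot k') lt)
  ... | inj₁ q<q' = inj₁ q<q'
  ... | inj₂ (q≡q' , r<r') = inj₂ (toℕ-injective q≡q' , r<r')

  remQuot-consecutive : ∀ k k' → Consecutive k k' →
    (q k ≡ q k' × toℕ (r k') ≡ suc (toℕ (r k))) ⊎ (Consecutive (q k) (q k') × Wraps (r k) (r k'))
  remQuot-consecutive k k' (inj₁ next)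
    with lex-suc-inv n (toℕ<n (r k)) (toℕ<n (r k'))
           (trans (cong suc (sym (toℕ-remQuot k))) (trans (sym next) (toℕ-remQuot k')))
  ... | inj₁ (q≡q' , r'≡1+r) = inj₁ (toℕ-injective q≡q' , r'≡1+r)
  ... | inj₂ (q'≡1+q , wraps) = inj₂ (inj₁ q'≡1+q , wraps)
  remQuot-consecutive k k' (inj₂ (last , first))
    with q-last , r-last ← lex-last-inv m n (toℕ<n (r k))
                             (trans (cong suc (sym (toℕ-remQuot k))) last)
       | q-first , r-first ← lex-zero-inv n (toℕ<n (r k')) (trans (sym (toℕ-remQuot k')) first)
    = inj₂ (inj₂ (q-last , q-first) , r-last , r-first)

flatten : ∀ {A : Set} {m n} → (Fin m → Fin n → A) → Fin (m * n) → A
flatten {m = m} {n} W k = W (quotient {m} n k) (remainder {m} n k)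

flatten-cyclic : ∀ {d m n} (W : Fin m → Fin n → Vecℕ d) →
  (∀ c p p' → toℕ p' ≡ suc (toℕ p) → W c p ⇝ᵛ W c p') →
  (∀ c c' p p' → Consecutive c c' → Wraps p p' → W c p ⇝ᵛ W c' p') →
  Cyclic (flatten W)
flatten-cyclic {m = m} {n} W inner outer = cyclic-intro step
  where
  step : ∀ k k' → Consecutive k k' → flatten W k ⇝ᵛ flatten W k'
  step k k' next with remQuot-consecutive {m} n k k' next
  ... | inj₁ (c≡c' , p'≡1+p) = subst (λ c' → flatten W k ⇝ᵛ W c' _) c≡c' (inner _ _ _ p'≡1+p)
  ... | inj₂ (c→c' , wraps) = outer _ _ _ _ c→c' wraps

repeat : ∀ {d} m {n} → Seq d n → Seq d (m * n)
repeat m S = flatten {m = m} λ _ p → S p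

repeat-cyclic : ∀ {d} m {n} {S : Seq d n} → Cyclic S → Cyclic (repeat m S)
repeat-cyclic m {S = S} cyc = flatten-cyclic {m = m} (λ _ p → S p)
  (λ _ p p' p'≡1+p → cyclic-step cyc p p' (inj₁ p'≡1+p))
  (λ _ _ p p' _ wraps → cyclic-step cyc p p' (inj₂ wraps))

resetAt : ℕ → ℕ → ℕ
resetAt j p with p <? j
... | yes _ = p
... | no _ = p ∸ j

resetAt-below : ∀ {j p} → p < j → resetAt j p ≡ p
resetAt-below {j} {p} p<j with p <? j
... | yes _ = refl
... | no p≮j = contradiction p<j p≮j

resetAt-above : ∀ {j p} → j ≤ p → resetAt j p ≡ p ∸ j
resetAt-above {j} {p} j≤p with p <? j
... | yes p<j = contradiction j≤p (<⇒≱ p<j)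
... | no _ = refl

resetAt-≤ : ∀ j p → resetAt j p ≤ p
resetAt-≤ j p with p <? j
... | yes _ = ≤-refl
... | no _ = m∸n≤m p j

resetAt-suc : ∀ {j p} → j ≤ p → suc p ∸ j ≡ suc (resetAt j p)
resetAt-suc {j} {p} j≤p = trans (+-∸-assoc 1 j≤p) (cong suc (sym (resetAt-above j≤p)))

resetAt-step : ∀ j p → resetAt j p ⇝ resetAt j (suc p)
resetAt-step j p with <-cmp (suc p) j
... | tri< 1+p<j _ _ =
  inj₁ (trans (resetAt-below 1+p<j) (cong suc (sym (resetAt-below (<-trans (n<1+n p) 1+p<j)))))
... | tri≈ _ refl _ = inj₂ (trans (resetAt-above {suc p} ≤-refl) (n∸n≡0 (suc p)))
... | tri> _ _ j<1+p = inj₁ (trans (resetAt-above (<⇒≤ j<1+p)) (resetAt-suc (≤-pred j<1+p)))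

⇝ᵛ-pair : ∀ {a a' b b'} → a ⇝ a' → b ⇝ b' → (a ∷ b ∷ []) ⇝ᵛ (a' ∷ b' ∷ [])
⇝ᵛ-pair a⇝a' _ 0F = a⇝a'
⇝ᵛ-pair _ b⇝b' 1F = b⇝b'

module Gadget (N : ℕ) where

  descent : ℕ → ℕ → ℕ
  descent j p = p + (N ∸ j)

  gadget : ℕ → Fin 2 → ℕ → Vecℕ 2
  gadget j 0F p = resetAt j p ∷ descent j p ∷ []
  gadget j 1F p = descent j p ∷ resetAt (suc j) p ∷ []

  gadget-step : ∀ j b p → gadget j b p ⇝ᵛ gadget j b (suc p)
  gadget-step j 0F p = ⇝ᵛ-pair (resetAt-step j p) (inj₁ refl)
  gadget-step j 1F p = ⇝ᵛ-pair (inj₁ refl) (resetAt-step (suc j) p)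

  ⇝resetAt-zero : ∀ {a} j → a ⇝ resetAt j 0
  ⇝resetAt-zero j = inj₂ (n≤0⇒n≡0 (resetAt-≤ j 0))

  gadget-rung : ∀ {j p} → j < N → suc p ≡ N → gadget j 0F p ⇝ᵛ gadget j 1F 0
  gadget-rung {j} j<N refl = ⇝ᵛ-pair (inj₁ (resetAt-suc (≤-pred j<N))) (⇝resetAt-zero (suc j))

  gadget-jump : ∀ {p} (j j' : Fin N) → Consecutive j j' → suc p ≡ N →
                gadget (toℕ j) 1F p ⇝ᵛ gadget (toℕ j') 0F 0
  gadget-jump {p} j j' next last = ⇝ᵛ-pair (⇝resetAt-zero (toℕ j')) (inj₁ (reset⇝descent next))
    where
    reset⇝descent : Consecutive j j' → N ∸ toℕ j' ≡ suc (resetAt (suc (toℕ j)) p)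
    reset⇝descent (inj₁ j'≡1+j) = begin
      N ∸ toℕ j'          ≡⟨ cong₂ _∸_ (sym last) j'≡1+j ⟩
      suc p ∸ suc (toℕ j) ≡⟨ resetAt-suc (≤-pred (subst₂ _<_ j'≡1+j (sym last) (toℕ<n j'))) ⟩
      suc (resetAt (suc (toℕ j)) p) ∎
      where open ≡-Reasoning
    reset⇝descent (inj₂ (j-last , j'≡0)) = begin
      N ∸ toℕ j'                    ≡⟨ cong (N ∸_) j'≡0 ⟩
      N                             ≡⟨ last ⟨
      suc p                         ≡⟨ cong suc (resetAt-below (≤-reflexive 1+p≡1+j)) ⟨
      suc (resetAt (suc (toℕ j)) p) ∎
      where
      open ≡-Reasoning
      1+p≡1+j : suc p ≡ suc (toℕ j)
      1+p≡1+j = trans last (sym j-last)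

  gadget-outer : ∀ {p p'} (j j' : Fin N) (b b' : Fin 2) →
                 (j ≡ j' × toℕ b' ≡ suc (toℕ b)) ⊎ (Consecutive j j' × Wraps b b') →
                 suc p ≡ N → p' ≡ 0 → gadget (toℕ j) b p ⇝ᵛ gadget (toℕ j') b' p'
  gadget-outer j _ 0F 1F (inj₁ (refl , _)) last refl = gadget-rung (toℕ<n j) last
  gadget-outer j j' 1F 0F (inj₂ (next , _)) last refl = gadget-jump j j' next last
  gadget-outer _ _ 0F 0F (inj₁ (_ , ())) _ _
  gadget-outer _ _ 1F 0F (inj₁ (_ , ())) _ _
  gadget-outer _ _ 1F 1F (inj₁ (_ , ())) _ _
  gadget-outer _ _ 0F _ (inj₂ (_ , () , _)) _ _
  gadget-outer _ _ 1F 1F (inj₂ (_ , _ , ())) _ _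

  descent-< : ∀ {j j' p q} → j < j' → j' ≤ N → q ≤ p → descent j' q < descent j p
  descent-< j<j' j'≤N q≤p = +-mono-≤-< q≤p (∸-monoʳ-< j<j' j'≤N)

  <descent : ∀ {j p q} → j < N → q ≤ p → q < descent j p
  <descent {p = p} j<N q≤p = ≤-<-trans q≤p (m<m+n p (m<n⇒0<n∸m j<N))

  gadget-nonDominating : ∀ {j j' p q} b b' → j < N → j' < N → q ≤ p → j < j' ⊎ toℕ b < toℕ b' →
                         ¬ gadget j b p ≤ᵛ gadget j' b' q
  gadget-nonDominating 0F 0F _ j'<N q≤p (inj₁ j<j') le =
    <⇒≱ (descent-< j<j' (<⇒≤ j'<N) q≤p) (le 1F)
  gadget-nonDominating 1F 1F _ j'<N q≤p (inj₁ j<j') le =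
    <⇒≱ (descent-< j<j' (<⇒≤ j'<N) q≤p) (le 0F)
  gadget-nonDominating 1F 1F _ _ _ (inj₂ (s≤s ()))
  gadget-nonDominating {j' = j'} {q = q} 0F 1F j<N _ q≤p _ le =
    <⇒≱ (<descent j<N q≤p) (≤-trans (le 1F) (resetAt-≤ (suc j') q))
  gadget-nonDominating {j' = j'} {q = q} 1F 0F j<N _ q≤p _ le =
    <⇒≱ (<descent j<N q≤p) (≤-trans (le 0F) (resetAt-≤ j' q))

  block : Fin (N * 2) → Fin N → Vecℕ 2
  block c p = flatten {m = N} (λ j b → gadget (toℕ j) b (toℕ p)) c

  gadgetSeq : Seq 2 ((N * 2) * N)
  gadgetSeq = flatten {m = N * 2} block

  gadgetSeq-cyclic : Cyclic gadgetSeq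
  gadgetSeq-cyclic = flatten-cyclic {m = N * 2} block inner outer
    where
    inner : ∀ c p p' → toℕ p' ≡ suc (toℕ p) → block c p ⇝ᵛ block c p'
    inner c p p' p'≡1+p =
      subst (λ x → block c p ⇝ᵛ flatten {m = N} (λ j b → gadget (toℕ j) b x) c) (sym p'≡1+p)
            (gadget-step (toℕ (quotient {N} 2 c)) (remainder {N} 2 c) (toℕ p))
    outer : ∀ c c' p p' → Consecutive c c' → Wraps p p' → block c p ⇝ᵛ block c' p'
    outer c c' _ _ next (last , first) =
      gadget-outer _ _ _ _ (remQuot-consecutive {N} 2 c c' next) last first

  gadgetSeq-separates : ∀ k k' → toℕ k < toℕ k' →
    toℕ (remainder {N * 2} N k') ≤ toℕ (remainder {N * 2} N k) → ¬ gadgetSeq k ≤ᵛ gadgetSeq k'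
  gadgetSeq-separates k k' k<k' q≤p with remQuot-<-inv {N * 2} N k k' k<k'
  ... | inj₂ (_ , p<q) = contradiction q≤p (<⇒≱ p<q)
  ... | inj₁ c<c' =
    gadget-nonDominating _ _ (toℕ<n _) (toℕ<n _) q≤p (map₂ proj₂ (remQuot-<-inv {N} 2 _ _ c<c'))

doubling : ∀ {d N} {S : Seq d N} → CyclicNonDominating S →
           CyclicNonDominating (Gadget.gadgetSeq N ⊕ repeat (N * 2) S)
doubling {N = N} {S} (cyc , nd) =
  ⊕-cyclic (Gadget.gadgetSeq-cyclic N) (repeat-cyclic (N * 2) cyc) , ⊕-nonDominating separated
  where
  separated : ∀ k k' → toℕ k < toℕ k' →
              Gadget.gadgetSeq N k ≤ᵛ Gadget.gadgetSeq N k' →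
              repeat (N * 2) S k ≤ᵛ repeat (N * 2) S k' → ⊥
  separated k k' k<k' g≤g' s≤s' with toℕ (remainder {N * 2} N k) <? toℕ (remainder {N * 2} N k')
  ... | yes p<p' = nd _ _ p<p' s≤s'
  ... | no p≮p' = Gadget.gadgetSeq-separates N k k' k<k' (≮⇒≥ p≮p') g≤g'

_⇝?_ : Decidable _⇝_
a ⇝? b = (b ≟ suc a) ⊎-dec (b ≟ 0)

cyclic? : ∀ {d n} (v : Seq d n) → Dec (Cyclic v)
cyclic? {n = n} v =
  all? (λ i → all? λ j → (toℕ j ≟ suc (toℕ i)) →-dec step? i j) ×-dec
  all? (λ i → all? λ j → (suc (toℕ i) ≟ n) →-dec ((toℕ j ≟ 0) →-dec step? i j))
  where
  step? : ∀ i j → Dec (v i ⇝ᵛ v j)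
  step? i j = Pointwise.decidable _⇝?_ (v i) (v j)

nonDominating? : ∀ {d n} (v : Seq d n) → Dec (NonDominating v)
nonDominating? v =
  all? λ i → all? λ j → (toℕ i <? toℕ j) →-dec ¬? (Pointwise.decidable _≤?_ (v i) (v j))

square : Seq 2 4
square = (1 ∷ 1 ∷ []) ∷ (2 ∷ 0 ∷ []) ∷ (0 ∷ 1 ∷ []) ∷ (0 ∷ 0 ∷ []) ∷ []

square-cyclicNonDominating : CyclicNonDominating square
square-cyclicNonDominating = toWitness {a? = cyclic? square ×-dec nonDominating? square} tt

cycleLength : ℕ → ℕ
cycleLength e = 2 ^ (3 * 2 ^ e ∸ 1)

cycleLength-suc : ∀ e → cycleLength (suc e) ≡ (cycleLength e * 2) * cycleLength e
cycleLength-suc e = begin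
  2 ^ (3 * (2 * 2 ^ e) ∸ 1) ≡⟨ cong (λ x → 2 ^ (x ∸ 1)) 3*[2*x]≡2*[3*x] ⟩
  2 ^ (2 * (3 * 2 ^ e) ∸ 1) ≡⟨ cong (λ x → 2 ^ (2 * x ∸ 1)) 3*2^e≡1+a ⟩
  2 ^ (a + suc (a + 0))     ≡⟨ cong (λ x → 2 ^ (a + suc x)) (+-identityʳ a) ⟩
  2 ^ (a + suc a)           ≡⟨ ^-distribˡ-+-* 2 a (suc a) ⟩
  2 ^ a * (2 * 2 ^ a)       ≡⟨ *-assoc (2 ^ a) 2 (2 ^ a) ⟨
  (2 ^ a * 2) * 2 ^ a       ∎
  where
  open ≡-Reasoning
  a = 3 * 2 ^ e ∸ 1
  3*[2*x]≡2*[3*x] : 3 * (2 * 2 ^ e) ≡ 2 * (3 * 2 ^ e)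
  3*[2*x]≡2*[3*x] = trans (sym (*-assoc 3 2 (2 ^ e))) (*-assoc 2 3 (2 ^ e))
  3*2^e≡1+a : 3 * 2 ^ e ≡ suc a
  3*2^e≡1+a = sym (m+[n∸m]≡n (*-mono-≤ {1} {3} (s≤s z≤n) (m^n>0 2 e)))

half-suc : ∀ m → suc (suc m) / 2 ≡ suc (m / 2)
half-suc m = m/n≡1+[m∸n]/n {suc (suc m)} {2} (s≤s (s≤s z≤n))

longCycle : ∀ m → LongCycle (2 + m) (cycleLength (m / 2))
longCycle 0 = square , square-cyclicNonDominating
longCycle 1 = zeros ⊕ square , pad square-cyclicNonDominating
longCycle (suc (suc m)) with _ , cnd ← longCycle m =
  subst (LongCycle (4 + m))
        (trans (sym (cycleLength-suc (m / 2))) (cong cycleLength (sym (half-suc m))))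
        (_ , doubling cnd)

theorem2 : (d : ℕ) → 2 ≤ d →
    Σ (Seq d (2 ^ (3 * 2 ^ (d / 2 ∸ 1) ∸ 1))) (λ v → Cyclic v × NonDominating v)
    × ((Ld Lcd : ℕ) → IsL d Ld → IsL° d Lcd →
         (Lcd ≤ Ld) × (2 ^ (3 * 2 ^ (d / 2 ∸ 1) ∸ 1) ≤ Lcd))
theorem2 1 (s≤s ())
theorem2 (suc (suc m)) _ = cycle , bounds
  where
  cycle : LongCycle (2 + m) (cycleLength (suc (suc m) / 2 ∸ 1))
  cycle = subst (LongCycle (2 + m)) (cong (λ h → cycleLength (h ∸ 1)) (sym (half-suc m)))
                (longCycle m)

  bounds : ∀ Ld Lcd → IsL (2 + m) Ld → IsL° (2 + m) Lcd →
           (Lcd ≤ Ld) × (cycleLength (suc (suc m) / 2 ∸ 1) ≤ Lcd)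
  bounds _ Lcd (_ , maxL) ((v , (valid , _) , nd) , maxL°) =
    maxL Lcd v (valid , nd) , maxL° _ (proj₁ cycle) (proj₂ cycle)
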